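{- There is an infinite set $N$ of positive integers such that for every $n \in N$ there exists a sequence of $3n$ intermixed insertions and deletions, performed with the AVL insertion and deletion algorithms described below starting from the empty tree, whose total number of rotations is $\Theta(n \log n)$ (as $n \to \infty$ within $N$).
   Context: A ranked binary tree is a binary tree in which each node $x$ has a non-negative integer rank $x.r$; a missing node has rank $-1$. For a child $x$ with parent $p$, its rank difference is $p.r - x.r$; a child with rank difference $i$ is an $i$-child, and a node whose two children have rank differences $i \le j$ is an $i,j$ node. An AVL tree is a ranked binary tree in which every node is $1,1$ or $1,2$. Trees are binary search trees with keys in symmetric order; rotations are the standard local restructurings preserving symmetric order. AVL insertion of a key: replace the missing node at the position found by binary search with a new leaf of rank $0$. While some node $p$ has a $0$-child $x$: if $x$'s sibling is a $1$-child, promote $p$ (increase $p.r$ by $1$) and continue at $p$'s parent; otherwise let $z$ be the child of $x$ on the side opposite to $x$'s side relative to $p$: if $z$ is missing or a $2$-child of $x$, single rotation at $x$ and decrease $p.r$ by $1$, stop; otherwise double rotation making $z$ the parent of $x$ and $p$, increase $z.r$ by $1$, decrease $x.r$ and $p.r$ by $1$, stop. AVL deletion of a leaf: replace it by a missing node; deletion of a unary node: replace it by its child; deletion of a binary node: first swap it with its symmetric-order successor or predecessor, then delete as a leaf or unary node. While there is a violating node $p$ ($2,2$ or $1,3$): if $p$ is $2,2$, decrease $p.r$ by $1$ and continue at its parent. If $p$ is $1,3$ with $1$-child $y$ and $r = p.r$: if $y$ is $1,1$, single rotation at $y$, $p.r \gets r-1$, $y.r \gets r$, stop; if $y$ is $1,2$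 with its outer child a $1$-child, single rotation at $y$, $p.r \gets r-2$, $y.r \gets r-1$, continue at $y$'s parent; otherwise double rotation at $y$'s inner child $z$, with $z.r \gets r-1$, $y.r \gets r-2$, $p.r \gets r-2$, continue at $z$'s parent. A single rotation counts as one rotation and a double rotation as two. -}

module Defs where

open import Data.Nat using (ℕ; zero; suc; _+_; _*_; _∸_; _≡ᵇ_; _<ᵇ_)
open import Data.Bool using (Bool; true; false; if_then_else_; _∧_)
open import Data.Maybe using (Maybe; just; nothing; _>>=_)
import Data.Maybe as M
open import Data.Product using (_×_; _,_)
open import Data.List using (List; []; _∷_)

-- Ranked binary search trees with natural-number keys.
-- node l k r s : left subtree l, key k, rank r (a non-negative integer,
-- exactly as in the paper), right subtree s.  nil is a missing node.

data Tree : Set where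
  nil  : Tree
  node : Tree → ℕ → ℕ → Tree → Tree

-- rank + 1 (so that a missing node, of rank -1, gets 0)
rk1 : Tree → ℕ
rk1 nil            = 0
rk1 (node _ _ r _) = suc r

-- rank difference of child x under a parent of rank r:  r - x.r
-- (= (r + 1) - (x.r + 1); only used where it is non-negative / tested
-- against positive values, where truncation of ∸ is irrelevant)
rdiff : ℕ → Tree → ℕ
rdiff r x = suc r ∸ rk1 x

isZeroChild : ℕ → Tree → Bool
isZeroChild r x = rk1 x ≡ᵇ suc r

-- results carry the number of rotations performed
-- (single rotation = 1, double rotation = 2)
addRot : ℕ → Tree × ℕ → Tree × ℕ
addRot c (t , c') = t , c + c'

-- p = node x k r s, where x (left child) is a 0-child whose sibling s is not
-- a 1-child.  z is the right child of x.
insRotL : Tree → ℕ → ℕ → Tree → Tree × ℕ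
insRotL nil k r s = node nil k r s , 0   -- impossible case
insRotL (node a kx rx nil) k r s =
  node a kx rx (node nil k (r ∸ 1) s) , 1
insRotL (node a kx rx (node b kz rz c)) k r s =
  if rdiff rx (node b kz rz c) ≡ᵇ 2
  then (node a kx rx (node (node b kz rz c) k (r ∸ 1) s) , 1)
  else (node (node a kx (rx ∸ 1) b) kz (suc rz) (node c k (r ∸ 1) s) , 2)

-- p = node s k r x, where x (right child) is a 0-child whose sibling s is
-- not a 1-child.  z is the left child of x.
insRotR : Tree → ℕ → ℕ → Tree → Tree × ℕ
insRotR s k r nil = node s k r nil , 0   -- impossible case
insRotR s k r (node nil kx rx a) =
  node (node s k (r ∸ 1) nil) kx rx a , 1
insRotR s k r (node (node c kz rz b) kx rx a) =
  if rdiff rx (node c kz rz b) ≡ᵇ 2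
  then (node (node s k (r ∸ 1) (node c kz rz b)) kx rx a , 1)
  else (node (node s k (r ∸ 1) c) kz (suc rz) (node b kx (rx ∸ 1) a) , 2)

insFixL : Tree → ℕ → ℕ → Tree → Tree × ℕ
insFixL x k r s =
  if isZeroChild r x
  then (if rdiff r s ≡ᵇ 1 then (node x k (suc r) s , 0) else insRotL x k r s)
  else (node x k r s , 0)

insFixR : Tree → ℕ → ℕ → Tree → Tree × ℕ
insFixR s k r x =
  if isZeroChild r x
  then (if rdiff r s ≡ᵇ 1 then (node s k (suc r) x , 0) else insRotR s k r x)
  else (node s k r x , 0)

ins : ℕ → Tree → Maybe (Tree × ℕ)
ins k nil = just (node nil k 0 nil , 0)
ins k (node l k' r s) =
  if k <ᵇ k'
  then M.map (λ { (l' , c) → addRot c (insFixL l' k' r s) }) (ins k l)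
  else (if k' <ᵇ k
        then M.map (λ { (s' , c) → addRot c (insFixR l k' r s') }) (ins k s)
        else nothing)

-- p = node y k r s is 1,3 with left 1-child y (outer child a, inner child b)
delRotL : Tree → ℕ → ℕ → Tree → Tree × ℕ
delRotL nil k r s = node nil k r s , 0   -- impossible case
delRotL (node a ky ry b) k r s =
  if (rdiff ry a ≡ᵇ 1) ∧ (rdiff ry b ≡ᵇ 1)
  then (node a ky r (node b k (r ∸ 1) s) , 1)
  else (if (rdiff ry a ≡ᵇ 1) ∧ (rdiff ry b ≡ᵇ 2)
        then (node a ky (r ∸ 1) (node b k (r ∸ 2) s) , 1)
        else dbl b)
  where
  dbl : Tree → Tree × ℕ
  dbl nil = node (node a ky ry nil) k r s , 0   -- impossible case
  dbl (node c kz rz d) =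
    node (node a ky (r ∸ 2) c) kz (r ∸ 1) (node d k (r ∸ 2) s) , 2

-- p = node l k r y is 1,3 with right 1-child y (outer child a, inner child b)
delRotR : Tree → ℕ → ℕ → Tree → Tree × ℕ
delRotR l k r nil = node l k r nil , 0   -- impossible case
delRotR l k r (node b ky ry a) =
  if (rdiff ry a ≡ᵇ 1) ∧ (rdiff ry b ≡ᵇ 1)
  then (node (node l k (r ∸ 1) b) ky r a , 1)
  else (if (rdiff ry a ≡ᵇ 1) ∧ (rdiff ry b ≡ᵇ 2)
        then (node (node l k (r ∸ 2) b) ky (r ∸ 1) a , 1)
        else dbl b)
  where
  dbl : Tree → Tree × ℕ
  dbl nil = node l k r (node nil ky ry a) , 0   -- impossible case
  dbl (node c kz rz d) =
    node (node l k (r ∸ 2) c) kz (r ∸ 1) (node d ky (r ∸ 2) a) , 2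

delFix : Tree → ℕ → ℕ → Tree → Tree × ℕ
delFix l k r s =
  if (rdiff r l ≡ᵇ 2) ∧ (rdiff r s ≡ᵇ 2)
  then (node l k (r ∸ 1) s , 0)
  else (if (rdiff r l ≡ᵇ 1) ∧ (rdiff r s ≡ᵇ 3)
        then delRotL l k r s
        else (if (rdiff r l ≡ᵇ 3) ∧ (rdiff r s ≡ᵇ 1)
              then delRotR l k r s
              else (node l k r s , 0)))

delMin : Tree → Maybe (ℕ × Tree × ℕ)
delMin nil = nothing
delMin (node nil k r s) = just (k , s , 0)
delMin (node l@(node _ _ _ _) k r s) =
  M.map (λ { (m , l' , c) → m , addRot c (delFix l' k r s) }) (delMin l)

delMax : Tree → Maybe (ℕ × Tree × ℕ)
delMax nil = nothing
delMax (node l k r nil) = just (k , l , 0)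
delMax (node l k r s@(node _ _ _ _)) =
  M.map (λ { (m , s' , c) → m , addRot c (delFix l k r s') }) (delMax s)

-- for a binary node: swap with the symmetric-order successor or predecessor
data Side : Set where
  successor predecessor : Side

removeNode : Side → Tree → ℕ → ℕ → Tree → Maybe (Tree × ℕ)
removeNode σ nil k r s = just (s , 0)
removeNode σ l@(node _ _ _ _) k r nil = just (l , 0)
removeNode successor l@(node _ _ _ _) k r s@(node _ _ _ _) =
  M.map (λ { (m , s' , c) → addRot c (delFix l m r s') }) (delMin s)
removeNode predecessor l@(node _ _ _ _) k r s@(node _ _ _ _) =
  M.map (λ { (m , l' , c) → addRot c (delFix l' m r s) }) (delMax l)

del : Side → ℕ → Tree → Maybe (Tree × ℕ)
del σ k nil = nothing
del σ k (node l k' r s) =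
  if k <ᵇ k'
  then M.map (λ { (l' , c) → addRot c (delFix l' k' r s) }) (del σ k l)
  else (if k' <ᵇ k
        then M.map (λ { (s' , c) → addRot c (delFix l k' r s') }) (del σ k s)
        else removeNode σ l k' r s)

data Op : Set where
  insert : ℕ → Op
  delete : Side → ℕ → Op

step : Op → Tree → Maybe (Tree × ℕ)
step (insert k)   t = ins k t
step (delete σ k) t = del σ k t

run : List Op → Tree → Maybe (Tree × ℕ)
run [] t = just (t , 0)
run (o ∷ os) t = step o t >>= λ { (t' , c) → M.map (addRot c) (run os t') }

module Submission where

-- For each m let
-- Tₘ be the Fibonacci tree of rank 2m on consecutive keys and n = |Tₘ|; then
-- 2^m ≤ n ≤ 2^(2m+1), so m ≤ ⌊log₂ n⌋ ≤ 3m.  The sequence of 3n operations first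
-- inserts the keys of Tₘ in level order and then n times deletes a particular
-- "victim" key and re-inserts it.  Two general facts carry the argument:
--  * Cycling.  The family `Costly m` of AVL trees of rank 2m (which contains Tₘ)
--    is closed under "delete the victim, re-insert it"; the deletion performs
--    exactly m single rotations (at every second node of the victim's search
--    path) and the re-insertion none (deleteVictim, reinsertVictim).
--  * Building.  Inserting the keys of any height-balanced search tree in level
--    order performs no rotation and reproduces that tree (buildRun); the proof
--    compares AVL insertion with plain (unbalanced) leaf insertion.
-- Hence the 3n operations perform exactly n·m rotations, which is Θ(n log n).

open import Defs
open import Data.Nat
open import Data.Nat.Properties
open import Data.Nat.Logarithm using (⌊log₂_⌋; ⌊log₂⌋-mono-≤; ⌊log₂[2^n]⌋≡n)
open import Data.Bool using (true; false; T)
open import Data.Maybe using (just)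
import Data.Maybe as Maybe
open import Data.Product using (Σ; _×_; _,_; proj₁; proj₂)
open import Data.Sum using (inj₁; inj₂)
open import Data.Empty using (⊥-elim)
open import Data.List using (List; []; _∷_; _++_; length; map)
open import Data.List.Properties using (length-++; length-map)
open import Data.List.Relation.Unary.All using (All; []; _∷_)
import Data.List.Relation.Unary.All as All
open import Data.List.Relation.Unary.All.Properties using (++⁺)
open import Relation.Binary.PropositionalEquality
open import Algebra.Properties.CommutativeSemigroup +-commutativeSemigroup
  using () renaming (interchange to +-interchange)
open import Algebra.Properties.CommutativeSemigroup *-commutativeSemigroup
  using () renaming (x∙yz≈y∙xz to *-left-swap)

≡ᵇ-refl : ∀ n → (n ≡ᵇ n) ≡ true
≡ᵇ-refl zero    = refl
≡ᵇ-refl (suc n) = ≡ᵇ-refl n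

≡ᵇ-true⇒≡ : ∀ {m n} → (m ≡ᵇ n) ≡ true → m ≡ n
≡ᵇ-true⇒≡ {m} {n} eq = ≡ᵇ⇒≡ m n (subst T (sym eq) _)

≡ᵇ-false⇒≢ : ∀ {m n} → (m ≡ᵇ n) ≡ false → m ≢ n
≡ᵇ-false⇒≢ {m} eq refl with () ← trans (sym (≡ᵇ-refl m)) eq

<⇒<ᵇ-true : ∀ m n → m < n → (m <ᵇ n) ≡ true
<⇒<ᵇ-true zero    (suc n) _       = refl
<⇒<ᵇ-true (suc m) (suc n) (s≤s p) = <⇒<ᵇ-true m n p

≥⇒<ᵇ-false : ∀ m n → n ≤ m → (m <ᵇ n) ≡ false
≥⇒<ᵇ-false m       zero    _       = refl
≥⇒<ᵇ-false (suc m) (suc n) (s≤s p) = ≥⇒<ᵇ-false m n p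

ins-left : ∀ x k r l s → x < k →
  ins x (node l k r s) ≡ Maybe.map (λ { (l' , c) → addRot c (insFixL l' k r s) }) (ins x l)
ins-left x k r l s x<k rewrite <⇒<ᵇ-true x k x<k = refl

ins-right : ∀ x k r l s → k < x →
  ins x (node l k r s) ≡ Maybe.map (λ { (s' , c) → addRot c (insFixR l k r s') }) (ins x s)
ins-right x k r l s k<x rewrite ≥⇒<ᵇ-false x k (<⇒≤ k<x) | <⇒<ᵇ-true k x k<x = refl

del-left : ∀ σ x k r l s → x < k →
  del σ x (node l k r s) ≡ Maybe.map (λ { (l' , c) → addRot c (delFix l' k r s) }) (del σ x l)
del-left σ x k r l s x<k rewrite <⇒<ᵇ-true x k x<k = refl

del-right : ∀ σ x k r l s → k < x →
  del σ x (node l k r s) ≡ Maybe.map (λ { (s' , c) → addRot c (delFix l k r s') }) (del σ x s)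
del-right σ x k r l s k<x rewrite ≥⇒<ᵇ-false x k (<⇒≤ k<x) | <⇒<ᵇ-true k x k<x = refl

insFixL-promote : ∀ x k r s → rk1 x ≡ suc r → suc r ∸ rk1 s ≡ 1 →
  insFixL x k r s ≡ (node x k (suc r) s , 0)
insFixL-promote x k r s zero-child one-child rewrite zero-child | ≡ᵇ-refl r | one-child = refl

insFixR-promote : ∀ s k r x → rk1 x ≡ suc r → suc r ∸ rk1 s ≡ 1 →
  insFixR s k r x ≡ (node s k (suc r) x , 0)
insFixR-promote s k r x zero-child one-child rewrite zero-child | ≡ᵇ-refl r | one-child = refl

delFix-rotateL : ∀ D a ky b kp s → rk1 a ≡ suc D → rk1 b ≡ D → rk1 s ≡ D →
  delFix (node a ky (suc D) b) kp (suc (suc D)) s ≡ (node a ky (suc D) (node b kp D s) , 1)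
delFix-rotateL D a ky b kp s ra rb rs
  rewrite ra | rb | rs | m+n∸n≡m 1 D | m+n∸n≡m 2 D | m+n∸n≡m 3 D = refl

delFix-rotateR : ∀ D a ky b kp s → rk1 a ≡ D → rk1 b ≡ D → rk1 s ≡ suc D →
  delFix a ky (suc (suc D)) (node b kp (suc D) s) ≡ (node (node a ky D b) kp (suc D) s , 1)
delFix-rotateR D a ky b kp s ra rb rs
  rewrite ra | rb | rs | m+n∸n≡m 1 D | m+n∸n≡m 2 D | m+n∸n≡m 3 D = refl

-- `twice m` = 2m, defined by recursion so that the ranks below compute.

twice : ℕ → ℕ
twice zero    = 0
twice (suc m) = suc (suc (twice m))

twice≡m+m : ∀ m → twice m ≡ m + m
twice≡m+m zero    = refl
twice≡m+m (suc m) = cong suc (trans (cong suc (twice≡m+m m)) (sym (+-suc m m)))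

-- Costly m lo hi t: t has rank 2m and, for m > 0, a 1,2 root whose 1-child is
-- 1,2 with outer 1-child; this outer grandchild and the root's 2-child are
-- Costly (m - 1), with keys in [lo, hi) placed in search order (the remaining
-- grandchild is arbitrary).  The victim lies below the root's 2-child: deleting
-- it shrinks that child, making the root 1,3 over a 1,2 child with outer 1-child,
-- which costs one single rotation and lowers the rank, so the effect propagates.

data Costly : ℕ → ℕ → ℕ → Tree → Set where
  leaf       : ∀ {lo hi x} → lo ≤ x → x < hi → Costly 0 lo hi (node nil x 0 nil)
  leftHeavy  : ∀ {m lo hi a ky b kp s} →
               Costly m lo ky a → ky < kp → Costly m (suc kp) hi s → rk1 b ≡ twice m →
               Costly (suc m) lo hi (node (node a ky (suc (twice m)) b) kp (suc (suc (twice m))) s)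
  rightHeavy : ∀ {m lo hi a ky b kp s} →
               Costly m lo ky a → ky < kp → Costly m (suc kp) hi s → rk1 b ≡ twice m →
               Costly (suc m) lo hi (node a ky (suc (suc (twice m))) (node b kp (suc (twice m)) s))

rank-costly : ∀ {m lo hi t} → Costly m lo hi t → rk1 t ≡ suc (twice m)
rank-costly (leaf _ _)           = refl
rank-costly (leftHeavy _ _ _ _)  = refl
rank-costly (rightHeavy _ _ _ _) = refl

victim : ∀ {m lo hi t} → Costly m lo hi t → ℕ
victim (leaf {x = x} _ _)     = x
victim (leftHeavy _ _ es _)   = victim es
victim (rightHeavy ea _ _ _)  = victim ea

victim-bounds : ∀ {m lo hi t} → (e : Costly m lo hi t) → lo ≤ victim e × victim e < hi
victim-bounds (leaf lo≤x x<hi) = lo≤x , x<hi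
victim-bounds (leftHeavy ea ky<kp es _) =
  let (kp<x , x<hi) = victim-bounds es ; (lo≤y , y<ky) = victim-bounds ea in
  ≤-trans lo≤y (≤-trans (<⇒≤ y<ky) (≤-trans (<⇒≤ ky<kp) (≤-trans (n≤1+n _) kp<x))) , x<hi
victim-bounds (rightHeavy ea ky<kp es _) =
  let (lo≤x , x<ky) = victim-bounds ea ; (kp<y , y<hi) = victim-bounds es in
  lo≤x , ≤-trans x<ky (≤-trans (<⇒≤ ky<kp) (≤-trans (n≤1+n _) (≤-trans kp<y (<⇒≤ y<hi))))

shrunk : ∀ {m lo hi t} → Costly m lo hi t → Tree
shrunk (leaf _ _) = nil
shrunk (leftHeavy {m} {a = a} {ky} {b} {kp} _ _ es _) =
  node a ky (suc (twice m)) (node b kp (twice m) (shrunk es))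
shrunk (rightHeavy {m} {ky = ky} {b = b} {kp = kp} {s = s} ea _ _ _) =
  node (node (shrunk ea) ky (twice m) b) kp (suc (twice m)) s

rank-shrunk : ∀ {m lo hi t} (e : Costly m lo hi t) → rk1 (shrunk e) ≡ twice m
rank-shrunk (leaf _ _)           = refl
rank-shrunk (leftHeavy _ _ _ _)  = refl
rank-shrunk (rightHeavy _ _ _ _) = refl

cycled : ∀ {m lo hi t} → Costly m lo hi t → Tree
cycled (leaf {x = x} _ _) = node nil x 0 nil
cycled (leftHeavy {m} {a = a} {ky} {b} {kp} _ _ es _) =
  node a ky (suc (suc (twice m))) (node b kp (suc (twice m)) (cycled es))
cycled (rightHeavy {m} {ky = ky} {b = b} {kp = kp} {s = s} ea _ _ _) =
  node (node (cycled ea) ky (suc (twice m)) b) kp (suc (suc (twice m))) s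

cycled-costly : ∀ {m lo hi t} (e : Costly m lo hi t) → Costly m lo hi (cycled e)
cycled-costly (leaf lo≤x x<hi)         = leaf lo≤x x<hi
cycled-costly (leftHeavy ea lt es rb)  = rightHeavy ea lt (cycled-costly es) rb
cycled-costly (rightHeavy ea lt es rb) = leftHeavy (cycled-costly ea) lt es rb

del-leftHeavy : ∀ m x a ky b kp s s⁻ → kp < x → del successor x s ≡ just (s⁻ , m) →
  rk1 a ≡ suc (twice m) → rk1 b ≡ twice m → rk1 s⁻ ≡ twice m →
  del successor x (node (node a ky (suc (twice m)) b) kp (suc (suc (twice m))) s)
    ≡ just (node a ky (suc (twice m)) (node b kp (twice m) s⁻) , suc m)
del-leftHeavy m x a ky b kp s s⁻ kp<x del-s ra rb rs
  rewrite del-right successor x kp (suc (suc (twice m))) (node a ky (suc (twice m)) b) s kp<x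
        | del-s | delFix-rotateL (twice m) a ky b kp s⁻ ra rb rs | +-comm m 1 = refl

del-rightHeavy : ∀ m x a a⁻ ky b kp s → x < ky → del successor x a ≡ just (a⁻ , m) →
  rk1 a⁻ ≡ twice m → rk1 b ≡ twice m → rk1 s ≡ suc (twice m) →
  del successor x (node a ky (suc (suc (twice m))) (node b kp (suc (twice m)) s))
    ≡ just (node (node a⁻ ky (twice m) b) kp (suc (twice m)) s , suc m)
del-rightHeavy m x a a⁻ ky b kp s x<ky del-a ra rb rs
  rewrite del-left successor x ky (suc (suc (twice m))) a (node b kp (suc (twice m)) s) x<ky
        | del-a | delFix-rotateR (twice m) a⁻ ky b kp s ra rb rs | +-comm m 1 = refl

deleteVictim : ∀ {m lo hi t} (e : Costly m lo hi t) →
  del successor (victim e) t ≡ just (shrunk e , m)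
deleteVictim (leaf {x = x} _ _) rewrite ≥⇒<ᵇ-false x x ≤-refl = refl
deleteVictim (leftHeavy {m} {a = a} {ky} {b} {kp} {s} ea _ es rb) =
  del-leftHeavy m (victim es) a ky b kp s (shrunk es) (proj₁ (victim-bounds es))
    (deleteVictim es) (rank-costly ea) rb (rank-shrunk es)
deleteVictim (rightHeavy {m} {a = a} {ky} {b} {kp} {s} ea _ es rb) =
  del-rightHeavy m (victim ea) a (shrunk ea) ky b kp s (proj₂ (victim-bounds ea))
    (deleteVictim ea) (rank-shrunk ea) rb (rank-costly es)

ins-leftHeavy : ∀ D x a ky b kp s⁻ s' → ky < x → kp < x → ins x s⁻ ≡ just (s' , 0) →
  rk1 s' ≡ suc D → rk1 b ≡ D → rk1 a ≡ suc D →
  ins x (node a ky (suc D) (node b kp D s⁻))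
    ≡ just (node a ky (suc (suc D)) (node b kp (suc D) s') , 0)
ins-leftHeavy D x a ky b kp s⁻ s' ky<x kp<x ins-s rs rb ra
  rewrite ins-right x ky (suc D) a (node b kp D s⁻) ky<x | ins-right x kp D b s⁻ kp<x | ins-s
        | insFixR-promote b kp D s' rs (trans (cong (suc D ∸_) rb) (m+n∸n≡m 1 D))
        | insFixR-promote a ky (suc D) (node b kp (suc D) s') refl
            (trans (cong (suc (suc D) ∸_) ra) (m+n∸n≡m 1 D)) = refl

ins-rightHeavy : ∀ D x a⁻ ky b kp s a' → x < ky → x < kp → ins x a⁻ ≡ just (a' , 0) →
  rk1 a' ≡ suc D → rk1 b ≡ D → rk1 s ≡ suc D →
  ins x (node (node a⁻ ky D b) kp (suc D) s)
    ≡ just (node (node a' ky (suc D) b) kp (suc (suc D)) s , 0)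
ins-rightHeavy D x a⁻ ky b kp s a' x<ky x<kp ins-a ra rb rs
  rewrite ins-left x kp (suc D) (node a⁻ ky D b) s x<kp | ins-left x ky D a⁻ b x<ky | ins-a
        | insFixL-promote a' ky D b ra (trans (cong (suc D ∸_) rb) (m+n∸n≡m 1 D))
        | insFixL-promote (node a' ky (suc D) b) kp (suc D) s refl
            (trans (cong (suc (suc D) ∸_) rs) (m+n∸n≡m 1 D)) = refl

reinsertVictim : ∀ {m lo hi t} (e : Costly m lo hi t) →
  ins (victim e) (shrunk e) ≡ just (cycled e , 0)
reinsertVictim (leaf _ _) = refl
reinsertVictim (leftHeavy {m} {a = a} {ky} {b} {kp} {s} ea ky<kp es rb) =
  let kp<x = proj₁ (victim-bounds es) in
  ins-leftHeavy (twice m) (victim es) a ky b kp (shrunk es) (cycled es) (<-trans ky<kp kp<x) kp<x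
    (reinsertVictim es) (rank-costly (cycled-costly es)) rb (rank-costly ea)
reinsertVictim (rightHeavy {m} {a = a} {ky} {b} {kp} {s} ea ky<kp es rb) =
  let x<ky = proj₂ (victim-bounds ea) in
  ins-rightHeavy (twice m) (victim ea) (shrunk ea) ky b kp s (cycled ea) x<ky (<-trans x<ky ky<kp)
    (reinsertVictim ea) (rank-costly (cycled-costly ea)) rb (rank-costly es)

cycleOps : ∀ {m lo hi t} → ℕ → Costly m lo hi t → List Op
cycleOps zero    e = []
cycleOps (suc i) e = delete successor (victim e) ∷ insert (victim e) ∷ cycleOps i (cycled-costly e)

length-cycleOps : ∀ {m lo hi t} i (e : Costly m lo hi t) → length (cycleOps i e) ≡ i + i
length-cycleOps zero    e = refl
length-cycleOps (suc i) e = cong suc (trans (cong suc (length-cycleOps i (cycled-costly e))) (sym (+-suc i i)))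

cycleRun : ∀ {m lo hi t} i (e : Costly m lo hi t) →
  Σ Tree λ t' → run (cycleOps i e) t ≡ just (t' , i * m)
cycleRun zero    e = _ , refl
cycleRun {m} {t = t} (suc i) e with cycleRun i (cycled-costly e)
... | t' , rest = t' , rounds
  where
  rounds : run (cycleOps (suc i) e) t ≡ just (t' , m + i * m)
  rounds rewrite deleteVictim e | reinsertVictim e | rest = refl

-- Height-balanced trees.  `join l k s` is the node whose rank is its height,
-- the rank every node gets when an AVL tree is grown without rotations.

join : Tree → ℕ → Tree → Tree
join l k s = node l k (rk1 l ⊔ rk1 s) s

data Balanced : Tree → Set where
  nil-balanced  : Balanced nil
  join-balanced : ∀ {l k s} → Balanced l → Balanced s →
                  rk1 l ≤ suc (rk1 s) → rk1 s ≤ suc (rk1 l) → Balanced (join l k s)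

data Inserted (x : ℕ) : Tree → Tree → Set where
  at-leaf  : Inserted x nil (node nil x 0 nil)
  go-left  : ∀ {l k r s l'} → x < k → Inserted x l l' → Inserted x (node l k r s) (join l' k s)
  go-right : ∀ {l k r s s'} → k < x → Inserted x s s' → Inserted x (node l k r s) (join l k s')

inserted-rank : ∀ {x t t'} → Balanced t → Inserted x t t' → rk1 t ≤ rk1 t' × rk1 t' ≤ suc (rk1 t)
inserted-rank nil-balanced at-leaf = z≤n , ≤-refl
inserted-rank (join-balanced {l} {s = s} hl _ _ _) (go-left _ il) =
  let (grew , by-one) = inserted-rank hl il in
  s≤s (⊔-monoˡ-≤ (rk1 s) grew) ,
  s≤s (≤-trans (⊔-monoˡ-≤ (rk1 s) by-one)
               (⊔-lub (s≤s (m≤m⊔n (rk1 l) (rk1 s))) (≤-trans (m≤n⊔m (rk1 l) (rk1 s)) (n≤1+n _))))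
inserted-rank (join-balanced {l} {s = s} _ hs _ _) (go-right _ is) =
  let (grew , by-one) = inserted-rank hs is in
  s≤s (⊔-monoʳ-≤ (rk1 l) grew) ,
  s≤s (≤-trans (⊔-monoʳ-≤ (rk1 l) by-one)
               (⊔-lub (≤-trans (m≤m⊔n (rk1 l) (rk1 s)) (n≤1+n _)) (s≤s (m≤n⊔m (rk1 l) (rk1 s)))))

promoted-sibling : ∀ A A' B → A' ≡ suc (A ⊔ B) → A' ≤ suc B → A ⊔ B ≡ B
promoted-sibling A A' B refl (s≤s A⊔B≤B) = ≤-antisym A⊔B≤B (m≤n⊔m A B)

promoted-height : ∀ A A' B → A' ≡ suc (A ⊔ B) → A' ≤ suc B → A' ⊔ B ≡ suc B
promoted-height A A' B zero-child A'≤ =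
  trans (m≥n⇒m⊔n≡m (≤-trans (m≤n⊔m A B) (≤-trans (n≤1+n _) (≤-reflexive (sym zero-child)))))
        (trans zero-child (cong suc (promoted-sibling A A' B zero-child A'≤)))

unchanged-height : ∀ A A' B → A ≤ A' → A' ≤ suc A → A' ≢ suc (A ⊔ B) → A ⊔ B ≡ A' ⊔ B
unchanged-height A A' B A≤A' A'≤ not-zero-child with m≤n⇒m<n∨m≡n A≤A'
... | inj₂ refl = refl
... | inj₁ A<A' with ≤-antisym A'≤ A<A'
...   | refl with ≤-total A B
...     | inj₂ B≤A = ⊥-elim (not-zero-child (cong suc (sym (m≥n⇒m⊔n≡m B≤A))))
...     | inj₁ A≤B with m≤n⇒m<n∨m≡n A≤B
...       | inj₂ refl = ⊥-elim (not-zero-child (cong suc (sym (⊔-idem A))))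
...       | inj₁ A<B  = trans (m≤n⇒m⊔n≡n A≤B) (sym (m≤n⇒m⊔n≡n A<B))

insFixL-balanced : ∀ l' k s A → A ≤ rk1 l' → rk1 l' ≤ suc A → rk1 l' ≤ suc (rk1 s) →
  insFixL l' k (A ⊔ rk1 s) s ≡ (join l' k s , 0)
insFixL-balanced l' k s A grew by-one balanced with rk1 l' ≡ᵇ suc (A ⊔ rk1 s) in zero-child?
... | false = cong (λ r → node l' k r s , 0)
                (unchanged-height A (rk1 l') (rk1 s) grew by-one (≡ᵇ-false⇒≢ zero-child?))
... | true with ≡ᵇ-true⇒≡ zero-child?
...   | zero-child rewrite promoted-sibling A (rk1 l') (rk1 s) zero-child balanced
                         | m+n∸n≡m 1 (rk1 s) =
  cong (λ r → node l' k r s , 0) (sym (promoted-height A (rk1 l') (rk1 s) zero-child balanced))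

insFixR-balanced : ∀ l k s' A → A ≤ rk1 s' → rk1 s' ≤ suc A → rk1 s' ≤ suc (rk1 l) →
  insFixR l k (rk1 l ⊔ A) s' ≡ (join l k s' , 0)
insFixR-balanced l k s' A grew by-one balanced with rk1 s' ≡ᵇ suc (rk1 l ⊔ A) in zero-child?
... | false = cong (λ r → node l k r s' , 0)
                (trans (⊔-comm (rk1 l) A)
                  (trans (unchanged-height A (rk1 s') (rk1 l) grew by-one
                           (λ eq → ≡ᵇ-false⇒≢ zero-child? (trans eq (cong suc (⊔-comm A (rk1 l))))))
                         (⊔-comm (rk1 s') (rk1 l))))
... | true with trans (≡ᵇ-true⇒≡ zero-child?) (cong suc (⊔-comm (rk1 l) A))
...   | zero-child rewrite trans (⊔-comm (rk1 l) A) (promoted-sibling A (rk1 s') (rk1 l) zero-child balanced)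
                         | m+n∸n≡m 1 (rk1 l) =
  cong (λ r → node l k r s' , 0)
       (sym (trans (⊔-comm (rk1 l) (rk1 s')) (promoted-height A (rk1 s') (rk1 l) zero-child balanced)))

ins-balanced : ∀ {x t t'} → Balanced t → Inserted x t t' → Balanced t' → ins x t ≡ just (t' , 0)
ins-balanced nil-balanced at-leaf _ = refl
ins-balanced {x} (join-balanced {l} {k} {s} hl hs _ _) (go-left {l' = l'} x<k il)
             (join-balanced hl' _ balanced _)
  rewrite ins-left x k (rk1 l ⊔ rk1 s) l s x<k | ins-balanced hl il hl'
        | insFixL-balanced l' k s (rk1 l) (proj₁ (inserted-rank hl il)) (proj₂ (inserted-rank hl il))
            balanced = refl
ins-balanced {x} (join-balanced {l} {k} {s} hl hs _ _) (go-right {s' = s'} k<x is)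
             (join-balanced _ hs' _ balanced)
  rewrite ins-right x k (rk1 l ⊔ rk1 s) l s k<x | ins-balanced hs is hs'
        | insFixR-balanced l k s' (rk1 s) (proj₁ (inserted-rank hs is)) (proj₂ (inserted-rank hs is))
            balanced = refl

data PlainRun (P : Tree → Set) : List ℕ → Tree → Tree → Set where
  done : ∀ {X} → PlainRun P [] X X
  next : ∀ {x xs X X' Y} → Inserted x X X' → P X' → PlainRun P xs X' Y → PlainRun P (x ∷ xs) X Y

plainRun-++ : ∀ {P xs ys X Y Z} → PlainRun P xs X Y → PlainRun P ys Y Z → PlainRun P (xs ++ ys) X Z
plainRun-++ done            rest = rest
plainRun-++ (next i p run₁) rest = next i p (plainRun-++ run₁ rest)

plainRun-weaken : ∀ {P Q : Tree → Set} → (∀ {X} → P X → Q X) →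
  ∀ {xs X Y} → PlainRun P xs X Y → PlainRun Q xs X Y
plainRun-weaken f done            = done
plainRun-weaken f (next i p run₁) = next i (f p) (plainRun-weaken f run₁)

plainRun-left : ∀ {P Q : Tree → Set} k S → (∀ {X} → P X → Q (join X k S)) →
  ∀ {xs X Y} → All (_< k) xs → PlainRun P xs X Y → PlainRun Q xs (join X k S) (join Y k S)
plainRun-left k S f []           done            = done
plainRun-left k S f (x<k ∷ x<ks) (next i p run₁) = next (go-left x<k i) (f p) (plainRun-left k S f x<ks run₁)

plainRun-right : ∀ {P Q : Tree → Set} L k → (∀ {X} → P X → Q (join L k X)) →
  ∀ {xs X Y} → All (k <_) xs → PlainRun P xs X Y → PlainRun Q xs (join L k X) (join L k Y)
plainRun-right L k f []           done            = done
plainRun-right L k f (k<x ∷ k<xs) (next i p run₁) = next (go-right k<x i) (f p) (plainRun-right L k f k<xs run₁)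

run-balanced : ∀ {xs X Y} → Balanced X → PlainRun Balanced xs X Y → run (map insert xs) X ≡ just (Y , 0)
run-balanced hX done = refl
run-balanced hX (next i hX' run₁) rewrite ins-balanced hX i hX' | run-balanced hX' run₁ = refl

data Bounded : ℕ → ℕ → Tree → Set where
  nil-bounded  : ∀ {lo hi} → Bounded lo hi nil
  node-bounded : ∀ {lo hi l k r s} → lo ≤ k → k < hi → Bounded lo k l → Bounded (suc k) hi s →
                 Bounded lo hi (node l k r s)

level : ℕ → Tree → List ℕ
level _       nil            = []
level zero    (node _ k _ _) = k ∷ []
level (suc d) (node l _ _ s) = level d l ++ level d s

levelOrder : ℕ → Tree → List ℕ
levelOrder zero    T = []
levelOrder (suc D) T = levelOrder D T ++ level D T

prune : ℕ → Tree → Tree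
prune zero    _              = nil
prune (suc d) nil            = nil
prune (suc d) (node l k _ s) = join (prune d l) k (prune d s)

prune-nil : ∀ d → prune d nil ≡ nil
prune-nil zero    = refl
prune-nil (suc d) = refl

prune-balanced : ∀ T D → Balanced T → rk1 T ≤ D → prune D T ≡ T
prune-balanced nil D _ _ = prune-nil D
prune-balanced (node l k r s) (suc D) (join-balanced hl hs _ _) (s≤s hT≤D) =
  cong₂ (λ l' s' → join l' k s') (prune-balanced l D hl (≤-trans (m≤m⊔n _ _) hT≤D))
                                 (prune-balanced s D hs (≤-trans (m≤n⊔m _ _) hT≤D))

level-bounded : ∀ {lo hi T} d → Bounded lo hi T → All (λ x → lo ≤ x × x < hi) (level d T)
level-bounded d nil-bounded = []
level-bounded zero (node-bounded lo≤k k<hi _ _) = (lo≤k , k<hi) ∷ []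
level-bounded (suc d) (node-bounded lo≤k k<hi bl bs) =
  ++⁺ (All.map (λ (lo≤x , x<k) → lo≤x , <-trans x<k k<hi) (level-bounded d bl))
      (All.map (λ (k<x , x<hi) → ≤-trans lo≤k (≤-trans (n≤1+n _) k<x) , x<hi) (level-bounded d bs))

-- Partial d T X: X consists of the nodes of T at depth < d together with some of
-- its nodes at depth d, i.e. X lies between prune d T and prune (d + 1) T.  These
-- are the intermediate trees while level d is being inserted.

data Partial : ℕ → Tree → Tree → Set where
  partial-nil  : ∀ {d} → Partial d nil nil
  omitted      : ∀ {l k r s} → Partial 0 (node l k r s) nil
  included     : ∀ {l k r s} → Partial 0 (node l k r s) (node nil k 0 nil)
  partial-node : ∀ {d l k r s L S} → Partial d l L → Partial d s S → Partial (suc d) (node l k r s) (join L k S)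

partial-rank : ∀ {d T X} → Balanced T → Partial d T X → d ⊓ rk1 T ≤ rk1 X × rk1 X ≤ suc d ⊓ rk1 T
partial-rank {d} nil-balanced partial-nil = ≤-reflexive (⊓-zeroʳ d) , z≤n
partial-rank _ omitted  = z≤n , z≤n
partial-rank _ included = z≤n , s≤s z≤n
partial-rank {suc d} (join-balanced {l} {k} {s} hl hs _ _) (partial-node pl ps) =
  let (l-low , l-high) = partial-rank hl pl ; (s-low , s-high) = partial-rank hs ps in
  s≤s (≤-trans (≤-reflexive (⊓-distribˡ-⊔ d (rk1 l) (rk1 s))) (⊔-mono-≤ l-low s-low)) ,
  s≤s (≤-trans (⊔-mono-≤ l-high s-high) (≤-reflexive (sym (⊓-distribˡ-⊔ (suc d) (rk1 l) (rk1 s)))))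

partial-balanced : ∀ {d T X} → Balanced T → Partial d T X → Balanced X
partial-balanced _ partial-nil = nil-balanced
partial-balanced _ omitted     = nil-balanced
partial-balanced _ included    = join-balanced nil-balanced nil-balanced z≤n z≤n
partial-balanced {suc d} (join-balanced hl hs l≤s s≤l) (partial-node pl ps) =
  let (l-low , l-high) = partial-rank hl pl ; (s-low , s-high) = partial-rank hs ps in
  join-balanced (partial-balanced hl pl) (partial-balanced hs ps)
    (≤-trans l-high (≤-trans (⊓-monoʳ-≤ (suc d) l≤s) (s≤s s-low)))
    (≤-trans s-high (≤-trans (⊓-monoʳ-≤ (suc d) s≤l) (s≤s l-low)))

prune-partial : ∀ d T → Partial d T (prune d T)
prune-partial zero    nil            = partial-nil
prune-partial zero    (node l k r s) = omitted
prune-partial (suc d) nil            = partial-nil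
prune-partial (suc d) (node l k r s) = partial-node (prune-partial d l) (prune-partial d s)

prune-suc-partial : ∀ d T → Partial d T (prune (suc d) T)
prune-suc-partial d       nil            = partial-nil
prune-suc-partial zero    (node l k r s) = included
prune-suc-partial (suc d) (node l k r s) = partial-node (prune-suc-partial d l) (prune-suc-partial d s)

insertLevel : ∀ {lo hi} d T → Bounded lo hi T → PlainRun (Partial d T) (level d T) (prune d T) (prune (suc d) T)
insertLevel d nil _ rewrite prune-nil d = done
insertLevel zero (node l k r s) _ = next at-leaf included done
insertLevel (suc d) (node l k r s) (node-bounded _ _ bl bs) =
  plainRun-++
    (plainRun-left k (prune d s) (λ p → partial-node p (prune-partial d s))
      (All.map proj₂ (level-bounded d bl)) (insertLevel d l bl))
    (plainRun-right (prune (suc d) l) k (λ p → partial-node (prune-suc-partial d l) p)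
      (All.map proj₁ (level-bounded d bs)) (insertLevel d s bs))

insertLevels : ∀ {lo hi} T → Balanced T → Bounded lo hi T → ∀ D →
  PlainRun Balanced (levelOrder D T) nil (prune D T)
insertLevels T hT bT zero    = done
insertLevels T hT bT (suc D) =
  plainRun-++ (insertLevels T hT bT D) (plainRun-weaken (partial-balanced hT) (insertLevel D T bT))

buildRun : ∀ {lo hi} T → Balanced T → Bounded lo hi T →
  run (map insert (levelOrder (rk1 T) T)) nil ≡ just (T , 0)
buildRun T hT bT =
  trans (run-balanced nil-balanced (insertLevels T hT bT (rk1 T)))
        (cong (λ T' → just (T' , 0)) (prune-balanced T (rk1 T) hT ≤-refl))

size : Tree → ℕ
size nil            = 0
size (node l _ _ s) = suc (size l + size s)

length-level : ∀ d T → length (level d T) + size (prune d T) ≡ size (prune (suc d) T)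
length-level d nil rewrite prune-nil d = refl
length-level zero (node l k r s) = refl
length-level (suc d) (node l k r s) =
  begin
    length (level d l ++ level d s) + suc (size (prune d l) + size (prune d s))
      ≡⟨ cong (_+ suc (size (prune d l) + size (prune d s))) (length-++ (level d l)) ⟩
    (length (level d l) + length (level d s)) + suc (size (prune d l) + size (prune d s))
      ≡⟨ +-suc (length (level d l) + length (level d s)) _ ⟩
    suc ((length (level d l) + length (level d s)) + (size (prune d l) + size (prune d s)))
      ≡⟨ cong suc (+-interchange (length (level d l)) (length (level d s)) _ _) ⟩
    suc ((length (level d l) + size (prune d l)) + (length (level d s) + size (prune d s)))
      ≡⟨ cong suc (cong₂ _+_ (length-level d l) (length-level d s)) ⟩
    suc (size (prune (suc d) l) + size (prune (suc d) s))
  ∎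
  where open ≡-Reasoning

length-levelOrder : ∀ D T → length (levelOrder D T) ≡ size (prune D T)
length-levelOrder zero    T = refl
length-levelOrder (suc D) T =
  begin
    length (levelOrder D T ++ level D T)     ≡⟨ length-++ (levelOrder D T) ⟩
    length (levelOrder D T) + length (level D T) ≡⟨ cong (_+ length (level D T)) (length-levelOrder D T) ⟩
    size (prune D T) + length (level D T)    ≡⟨ +-comm (size (prune D T)) _ ⟩
    length (level D T) + size (prune D T)    ≡⟨ length-level D T ⟩
    size (prune (suc D) T)
  ∎
  where open ≡-Reasoning

run-++ : ∀ xs {ys t t₁ t₂ c₁ c₂} → run xs t ≡ just (t₁ , c₁) → run ys t₁ ≡ just (t₂ , c₂) →
  run (xs ++ ys) t ≡ just (t₂ , c₁ + c₂)
run-++ [] refl second = second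
run-++ (o ∷ os) {ys} {t} {t₂ = t₂} first second with step o t
... | just (t' , c) with run os t' in rest
...   | just (t₁ , c₁) with refl ← first rewrite run-++ os {ys} rest second =
  cong (λ c' → just (t₂ , c')) (sym (+-assoc c c₁ _))

fibSize : ℕ → ℕ
fibSize zero          = 0
fibSize (suc zero)    = 1
fibSize (suc (suc j)) = suc (fibSize (suc j) + fibSize j)

fibTree : ℕ → ℕ → Tree
fibTree zero          o = nil
fibTree (suc zero)    o = node nil o 0 nil
fibTree (suc (suc j)) o =
  node (fibTree (suc j) o) (o + fibSize (suc j)) (suc j) (fibTree j (suc (o + fibSize (suc j))))

rank-fibTree : ∀ j o → rk1 (fibTree j o) ≡ j
rank-fibTree zero          o = refl
rank-fibTree (suc zero)    o = refl
rank-fibTree (suc (suc j)) o = refl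

size-fibTree : ∀ j o → size (fibTree j o) ≡ fibSize j
size-fibTree zero          o = refl
size-fibTree (suc zero)    o = refl
size-fibTree (suc (suc j)) o = cong suc (cong₂ _+_ (size-fibTree (suc j) o) (size-fibTree j _))

fibTree-balanced : ∀ j o → Balanced (fibTree j o)
fibTree-balanced zero       o = nil-balanced
fibTree-balanced (suc zero) o = join-balanced nil-balanced nil-balanced z≤n z≤n
fibTree-balanced (suc (suc j)) o =
  subst (λ r → Balanced (node (fibTree (suc j) o) k r (fibTree j (suc k)))) height
    (join-balanced (fibTree-balanced (suc j) o) (fibTree-balanced j (suc k)) left≤ right≤)
  where
  k = o + fibSize (suc j)
  height : rk1 (fibTree (suc j) o) ⊔ rk1 (fibTree j (suc k)) ≡ suc j
  height rewrite rank-fibTree (suc j) o | rank-fibTree j (suc k) = m≥n⇒m⊔n≡m (n≤1+n j)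
  left≤ : rk1 (fibTree (suc j) o) ≤ suc (rk1 (fibTree j (suc k)))
  left≤ rewrite rank-fibTree (suc j) o | rank-fibTree j (suc k) = ≤-refl
  right≤ : rk1 (fibTree j (suc k)) ≤ suc (rk1 (fibTree (suc j) o))
  right≤ rewrite rank-fibTree (suc j) o | rank-fibTree j (suc k) = ≤-trans (n≤1+n j) (n≤1+n _)

-- Key arithmetic: the right subtree's keys start right after the root key and
-- end where the whole tree's keys end.

right-offset : ∀ o a b → suc (o + a) + b ≡ o + suc (a + b)
right-offset o a b = trans (cong suc (+-assoc o a b)) (sym (+-suc o (a + b)))

root-below-end : ∀ o a b → o + a < o + suc (a + b)
root-below-end o a b = +-monoʳ-< o (s≤s (m≤m+n a b))

fibTree-bounded : ∀ j o → Bounded o (o + fibSize j) (fibTree j o)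
fibTree-bounded zero       o = nil-bounded
fibTree-bounded (suc zero) o = node-bounded ≤-refl (≤-reflexive (+-comm 1 o)) nil-bounded nil-bounded
fibTree-bounded (suc (suc j)) o =
  node-bounded (m≤m+n o _) (root-below-end o _ _) (fibTree-bounded (suc j) o)
    (subst (λ hi → Bounded (suc k) hi (fibTree j (suc k))) (right-offset o (fibSize (suc j)) (fibSize j))
      (fibTree-bounded j (suc k)))
  where k = o + fibSize (suc j)

fibTree-costly : ∀ m o → Costly m o (o + fibSize (suc (twice m))) (fibTree (suc (twice m)) o)
fibTree-costly zero    o = leaf ≤-refl (≤-reflexive (+-comm 1 o))
fibTree-costly (suc m) o =
  leftHeavy (fibTree-costly m o) (root-below-end o _ _)
    (subst (λ hi → Costly m (suc k) hi (fibTree (suc (twice m)) (suc k)))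
      (right-offset o (fibSize (suc (suc (twice m)))) (fibSize (suc (twice m))))
      (fibTree-costly m (suc k)))
    (rank-fibTree (twice m) _)
  where k = o + fibSize (suc (suc (twice m)))

fibSize≤2^ : ∀ j → fibSize j ≤ 2 ^ j
fibSize≤2^ zero          = z≤n
fibSize≤2^ (suc zero)    = s≤s z≤n
fibSize≤2^ (suc (suc j)) =
  begin
    suc (fibSize (suc j) + fibSize j)   ≡⟨ sym (+-suc (fibSize (suc j)) (fibSize j)) ⟩
    fibSize (suc j) + suc (fibSize j)   ≤⟨ +-mono-≤ (fibSize≤2^ (suc j)) (+-mono-≤ (m^n>0 2 j) (fibSize≤2^ j)) ⟩
    2 ^ suc j + (2 ^ j + 2 ^ j)         ≡⟨ cong (2 ^ suc j +_) (cong (2 ^ j +_) (sym (+-identityʳ (2 ^ j)))) ⟩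
    2 ^ suc j + 2 ^ suc j               ≡⟨ cong (2 ^ suc j +_) (sym (+-identityʳ (2 ^ suc j))) ⟩
    2 ^ suc (suc j)
  ∎
  where open ≤-Reasoning

2^≤fibSize : ∀ m → 2 ^ m ≤ fibSize (suc (twice m))
2^≤fibSize zero    = ≤-refl
2^≤fibSize (suc m) =
  begin
    2 ^ m + (2 ^ m + 0)                   ≡⟨ cong (2 ^ m +_) (+-identityʳ (2 ^ m)) ⟩
    2 ^ m + 2 ^ m                         ≤⟨ +-mono-≤ (2^≤fibSize m) (2^≤fibSize m) ⟩
    fibSize (suc (twice m)) + fibSize (suc (twice m))
      ≤⟨ +-monoˡ-≤ (fibSize (suc (twice m))) (≤-trans (m≤m+n _ (fibSize (twice m))) (n≤1+n _)) ⟩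
    fibSize (suc (suc (twice m))) + fibSize (suc (twice m)) ≤⟨ n≤1+n _ ⟩
    fibSize (suc (twice (suc m)))
  ∎
  where open ≤-Reasoning

m≤fibSize : ∀ m → m ≤ fibSize (suc (twice m))
m≤fibSize zero    = z≤n
m≤fibSize (suc m) = s≤s (≤-trans (m≤fibSize m) (m≤n+m _ _))

log-lower : ∀ m → m ≤ ⌊log₂ fibSize (suc (twice m)) ⌋
log-lower m = ≤-trans (≤-reflexive (sym (⌊log₂[2^n]⌋≡n m))) (⌊log₂⌋-mono-≤ (2^≤fibSize m))

log-upper : ∀ m → ⌊log₂ fibSize (suc (twice m)) ⌋ ≤ 3 * m
log-upper zero    = ≤-refl
log-upper (suc m) =
  begin
    ⌊log₂ fibSize (suc (twice (suc m))) ⌋     ≤⟨ ⌊log₂⌋-mono-≤ (fibSize≤2^ (suc (twice (suc m)))) ⟩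
    ⌊log₂ 2 ^ suc (twice (suc m)) ⌋           ≡⟨ ⌊log₂[2^n]⌋≡n (suc (twice (suc m))) ⟩
    3 + twice m                              ≡⟨ cong (3 +_) (twice≡m+m m) ⟩
    3 + (m + m)                              ≤⟨ +-monoʳ-≤ 3 (+-monoʳ-≤ m (m≤m+n m (m + 0))) ⟩
    3 + (m + (m + (m + 0)))                  ≡⟨ sym (*-suc 3 m) ⟩
    3 * suc m
  ∎
  where open ≤-Reasoning

costlySequence : ∀ m → let n = fibSize (suc (twice m)) in
  Σ (List Op) λ ops → length ops ≡ 3 * n × Σ Tree λ t → run ops nil ≡ just (t , n * m)
costlySequence m = build ++ cycles , length-ok , proj₁ cycling , run-ok
  where
  n : ℕ
  n = fibSize (suc (twice m))
  tree : Tree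
  tree = fibTree (suc (twice m)) 0
  build cycles : List Op
  build  = map insert (levelOrder (rk1 tree) tree)
  cycles = cycleOps n (fibTree-costly m 0)
  cycling : Σ Tree λ t → run cycles tree ≡ just (t , n * m)
  cycling = cycleRun n (fibTree-costly m 0)

  length-build : length build ≡ n
  length-build =
    begin
      length (map insert (levelOrder (rk1 tree) tree))
        ≡⟨ length-map insert (levelOrder (rk1 tree) tree) ⟩
      length (levelOrder (rk1 tree) tree)
        ≡⟨ length-levelOrder (rk1 tree) tree ⟩
      size (prune (rk1 tree) tree)
        ≡⟨ cong size (prune-balanced tree (rk1 tree) (fibTree-balanced _ 0) ≤-refl) ⟩
      size tree
        ≡⟨ size-fibTree (suc (twice m)) 0 ⟩
      n
    ∎
    where open ≡-Reasoning

  length-ok : length (build ++ cycles) ≡ 3 * n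
  length-ok = trans (length-++ build)
    (trans (cong₂ _+_ length-build (length-cycleOps n (fibTree-costly m 0)))
           (cong (λ n' → n + (n + n')) (sym (+-identityʳ n))))

  run-ok : run (build ++ cycles) nil ≡ just (proj₁ cycling , n * m)
  run-ok = run-++ build (buildRun tree (fibTree-balanced _ 0) (fibTree-bounded _ 0)) (proj₂ cycling)

nlogn≤3nm : ∀ m → let n = fibSize (suc (twice m)) in n * ⌊log₂ n ⌋ ≤ 3 * (n * m)
nlogn≤3nm m =
  begin
    n * ⌊log₂ n ⌋  ≤⟨ *-monoʳ-≤ n (log-upper m) ⟩
    n * (3 * m)    ≡⟨ *-left-swap n 3 m ⟩
    3 * (n * m)
  ∎
  where
  open ≤-Reasoning
  n : ℕ
  n = fibSize (suc (twice m))

nm≤nlogn : ∀ m → let n = fibSize (suc (twice m)) in n * m ≤ 1 * (n * ⌊log₂ n ⌋)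
nm≤nlogn m = ≤-trans (*-monoʳ-≤ (fibSize (suc (twice m))) (log-lower m)) (≤-reflexive (sym (*-identityˡ _)))

FibonacciSize : ℕ → Set
FibonacciSize n = Σ ℕ λ m → n ≡ fibSize (suc (twice m))

ThetaNLogN : ℕ → ℕ → ℕ → ℕ → Set
ThetaNLogN a b n₀ n =
  Σ (List Op) λ ops → length ops ≡ 3 * n ×
  Σ Tree λ t → Σ ℕ λ R → run ops nil ≡ just (t , R) ×
  (n₀ ≤ n → (n * ⌊log₂ n ⌋ ≤ a * R) × (R ≤ b * (n * ⌊log₂ n ⌋)))

corollary1 :
    Σ (ℕ → Set) λ N →
      ((m : ℕ) → Σ ℕ λ n → m ≤ n × N n) ×
      ((n : ℕ) → N n → 1 ≤ n) ×
      (Σ ℕ λ a → Σ ℕ λ b → Σ ℕ λ n₀ →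
        (n : ℕ) → N n →
          Σ (List Op) λ ops →
            length ops ≡ 3 * n ×
            Σ Tree λ t → Σ ℕ λ R →
              run ops nil ≡ just (t , R) ×
              (n₀ ≤ n → (n * ⌊log₂ n ⌋ ≤ a * R) × (R ≤ b * (n * ⌊log₂ n ⌋))))
corollary1 = FibonacciSize , unbounded , positive , 3 , 1 , 0 , witness
  where
  unbounded : (m : ℕ) → Σ ℕ λ n → m ≤ n × FibonacciSize n
  unbounded m = fibSize (suc (twice m)) , m≤fibSize m , m , refl

  positive : (n : ℕ) → FibonacciSize n → 1 ≤ n
  positive _ (m , refl) = ≤-trans (m^n>0 2 m) (2^≤fibSize m)

  witness : (n : ℕ) → FibonacciSize n → ThetaNLogN 3 1 0 n
  witness _ (m , refl) with costlySequence m
  ... | ops , length-ok , t , run-ok =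
    ops , length-ok , t , _ , run-ok , λ _ → nlogn≤3nm m , nm≤nlogn m
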